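{- Let $d,t\ge1$ and let $\mathscr I$ be the set of multi-indices $\vec i=(i_1,\dots,i_t)$ of nonnegative integers with $i_1+\cdots+i_t\le d$. There is a constant $C$ depending only on $d,t$ such that the following holds. Let $L\ge1$, $\varepsilon>0$ and let $\mathscr Q\subset[L]^t$ be a set of size $\varepsilon L^t$. For each $\vec q\in\mathscr Q$ let $v_{\vec q}:=(\vec q^{\vec i})_{\vec i\in\mathscr I}\in\mathbb Q^{\mathscr I}$, where $\vec q^{\vec i}=\prod_jq_j^{i_j}$. If $L>C/\varepsilon$, then the vectors $v_{\vec q}$, $\vec q\in\mathscr Q$, span $\mathbb Q^{\mathscr I}$.
   Context: $[L]=\{1,\dots,L\}$. -}

module Defs where

open import Data.Nat as ℕ using (ℕ; _≤_; _^_)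
open import Data.Integer using (+_)
open import Data.Rational as ℚ using (ℚ; _/_; 0ℚ)
open import Data.Vec using (Vec; zipWith; foldr)
open import Data.List as List using (List)

toℚ : ℕ → ℚ
toℚ n = + n / 1

degree : ∀ {t} → Vec ℕ t → ℕ
degree = foldr _ ℕ._+_ 0

monomial : ∀ {t} → Vec ℕ t → Vec ℕ t → ℕ
monomial q i = foldr _ ℕ._*_ 1 (zipWith _^_ q i)

InBox : ∀ {t} → ℕ → Vec ℕ t → Set
InBox {t} L q = Data.Vec.Relation.Unary.All.All (λ x → 1 ≤ x × x ≤ L) q
  where open import Data.Product using (_×_)
        import Data.Vec.Relation.Unary.All

sumOver : ∀ {A : Set} → List A → (A → ℚ) → ℚ
sumOver xs f = List.foldr (λ x acc → f x ℚ.+ acc) 0ℚ xs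

-- the vectors v_q = (q^i)_{i ∈ 𝓘}, q ∈ 𝓠, span ℚ^𝓘 (𝓘 = {i : degree i ≤ d}):
-- every w ∈ ℚ^𝓘 is a ℚ-linear combination Σ_{q∈𝓠} c_q v_q.
SpansAll : ∀ {t} → ℕ → List (Vec ℕ t) → Set
SpansAll {t} d 𝓠 =
  (w : Vec ℕ t → ℚ) → Σ (Vec ℕ t → ℚ) λ c →
    (i : Vec ℕ t) → degree i ≤ d →
      sumOver 𝓠 (λ q → c q ℚ.* toℚ (monomial q i)) ≡ w i
  where open import Data.Product using (Σ)
        open import Relation.Binary.PropositionalEquality using (_≡_)

-- One may take C = d. Induction on t, and on d for fixed t. By pigeonhole some a ∈ [L] has a
-- fibre F = {q ∈ 𝓠 : q₁ = a} with |F| ≥ |𝓠|/L, so the tails of F are dense enough in [L]^(t-1)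
-- to span the monomials of degree ≤ d; as |F| ≤ L^(t-1), the rest R = 𝓠 ∖ F is still dense
-- enough in [L]^t to span those of degree < d. The two are combined through
-- q^(k+1,i) = a·q^(k,i) + (q₁ - a)·q^(k,i): the equations with first exponent k + 1 are solved
-- on R, where q₁ - a is invertible, and those with first exponent 0 on F, where it vanishes.
module Submission where

open import Defs
open import Data.Nat as ℕ using (ℕ; _≤_; _^_)
open import Data.Rational as ℚ using (ℚ; _<_; 0ℚ)
open import Data.Vec using (Vec)
open import Data.List using (List; length)
open import Data.List.Relation.Unary.All using (All)
open import Data.List.Relation.Unary.Unique.Propositional using (Unique)
open import Data.Product using (Σ)
open import Relation.Binary.PropositionalEquality using (_≡_)

open import Function using (_∘_; id)
open import Data.Nat using (zero; suc; _+_; _*_; z≤n; s≤s; s≤s⁻¹; >-nonZero)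
import Data.Nat.Properties as ℕP
import Data.Nat.Coprimality as Coprimality
open import Data.Integer as ℤ using (+_)
import Data.Integer.Properties as ℤP
open import Data.Rational using (mkℚ; 1ℚ; 1/_; ≢-nonZero)
import Data.Rational.Properties as ℚP
open import Data.Rational.Solver using (module +-*-Solver)
open import Data.Vec using ([]; _∷_; head; tail)
import Data.Vec.Relation.Unary.All as VecAll
open import Data.List using ([]; _∷_; map; filter)
import Data.List.Properties as ListP
import Data.List.Relation.Unary.All as All
open import Data.List.Relation.Unary.All using ([]; _∷_)
open import Data.List.Relation.Unary.All.Properties using (all-filter; filter⁺; map⁺)
open import Data.List.Relation.Unary.AllPairs using ([]; _∷_)
import Data.List.Relation.Unary.Unique.Propositional.Properties as Unique
import Data.List.Relation.Binary.Sublist.Propositional.Properties as Sublist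
open import Data.Product using (∃; _×_; _,_; proj₁; proj₂)
open import Data.Sum using (_⊎_; inj₁; inj₂)
open import Relation.Nullary using (¬_; yes; no)
open import Relation.Nullary.Negation using (contradiction)
open import Relation.Unary using (Pred; Decidable)
open import Relation.Unary.Properties using (∁?)
open import Relation.Binary.PropositionalEquality
  using (refl; sym; trans; cong; cong₂; subst; subst₂; _≢_; module ≡-Reasoning)

open +-*-Solver
open import Algebra.Properties.CommutativeSemigroup ℕP.*-commutativeSemigroup using (x∙yz≈y∙xz)

toℚ-mkℚ : ∀ n → toℚ n ≡ mkℚ (+ n) 0 (Coprimality.sym (Coprimality.1-coprimeTo n))
toℚ-mkℚ n = ℚP.normalize-coprime (Coprimality.sym (Coprimality.1-coprimeTo n))

toℚ-* : ∀ m n → toℚ (m * n) ≡ toℚ m ℚ.* toℚ n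
toℚ-* m n = trans (cong (ℚ._/ 1) (ℤP.pos-* m n)) (sym (cong₂ ℚ._*_ (toℚ-mkℚ m) (toℚ-mkℚ n)))

toℚ-injective : ∀ {m n} → toℚ m ≡ toℚ n → m ≡ n
toℚ-injective {m} {n} eq =
  ℤP.+-injective (cong ℚ.↥_ (trans (sym (toℚ-mkℚ m)) (trans eq (toℚ-mkℚ n))))

toℚ-cancel-< : ∀ {m n} → toℚ m < toℚ n → m ℕ.< n
toℚ-cancel-< {m} {n} lt = ℤP.drop‿+<+ (subst₂ ℤ._<_ (ℤP.*-identityʳ (+ m)) (ℤP.*-identityʳ (+ n))
  (ℚP.drop-*<* (subst₂ _<_ (toℚ-mkℚ m) (toℚ-mkℚ n) lt)))

toℚ-positive : ∀ {n} → 0 ℕ.< n → ℚ.Positive (toℚ n)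
toℚ-positive {suc n} _ = subst ℚ.Positive (sym (toℚ-mkℚ (suc n))) _

p-q≡0⇒p≡q : ∀ p q → p ℚ.- q ≡ 0ℚ → p ≡ q
p-q≡0⇒p≡q p q eq = begin
  p               ≡⟨ solve 2 (λ p q → p := (p :- q) :+ q) refl p q ⟩
  (p ℚ.- q) ℚ.+ q ≡⟨ cong (ℚ._+ q) eq ⟩
  0ℚ ℚ.+ q        ≡⟨ ℚP.+-identityˡ q ⟩
  q               ∎
  where open ≡-Reasoning

recip : ℚ → ℚ
recip p with p ℚP.≟ 0ℚ
... | yes _   = 0ℚ
... | no p≢0 = (1/ p) {{≢-nonZero p≢0}}

recip-inverseˡ : ∀ p → p ≢ 0ℚ → recip p ℚ.* p ≡ 1ℚ
recip-inverseˡ p p≢0 with p ℚP.≟ 0ℚ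
... | yes p≡0 = contradiction p≡0 p≢0
... | no p≢0′ = ℚP.*-inverseˡ p {{≢-nonZero p≢0′}}

module _ {A : Set} where

  sumOver-cong : ∀ {xs : List A} {f g : A → ℚ} → All (λ x → f x ≡ g x) xs → sumOver xs f ≡ sumOver xs g
  sumOver-cong []         = refl
  sumOver-cong (eq ∷ eqs) = cong₂ ℚ._+_ eq (sumOver-cong eqs)

  sumOver-zero : ∀ {xs : List A} {f : A → ℚ} → All (λ x → f x ≡ 0ℚ) xs → sumOver xs f ≡ 0ℚ
  sumOver-zero []         = refl
  sumOver-zero (eq ∷ eqs) = trans (cong₂ ℚ._+_ eq (sumOver-zero eqs)) (ℚP.+-identityˡ 0ℚ)

  sumOver-map : ∀ {B : Set} (h : A → B) (xs : List A) (f : B → ℚ) →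
                sumOver (map h xs) f ≡ sumOver xs (f ∘ h)
  sumOver-map h []       f = refl
  sumOver-map h (x ∷ xs) f = cong (f (h x) ℚ.+_) (sumOver-map h xs f)

  sumOver-+ : ∀ (xs : List A) (f g : A → ℚ) →
              sumOver xs (λ x → f x ℚ.+ g x) ≡ sumOver xs f ℚ.+ sumOver xs g
  sumOver-+ []       f g = sym (ℚP.+-identityˡ 0ℚ)
  sumOver-+ (x ∷ xs) f g = trans (cong ((f x ℚ.+ g x) ℚ.+_) (sumOver-+ xs f g))
    (solve 4 (λ a b c d → (a :+ b) :+ (c :+ d) := (a :+ c) :+ (b :+ d)) refl
      (f x) (g x) (sumOver xs f) (sumOver xs g))

  sumOver-*ˡ : ∀ k (xs : List A) (f : A → ℚ) → sumOver xs (λ x → k ℚ.* f x) ≡ k ℚ.* sumOver xs f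
  sumOver-*ˡ k []       f = sym (ℚP.*-zeroʳ k)
  sumOver-*ˡ k (x ∷ xs) f =
    trans (cong (k ℚ.* f x ℚ.+_) (sumOver-*ˡ k xs f)) (sym (ℚP.*-distribˡ-+ k (f x) _))

  module _ {p} {P : Pred A p} (P? : Decidable P) where

    sumOver-filter-∁ : ∀ xs (f : A → ℚ) →
                       sumOver xs f ≡ sumOver (filter P? xs) f ℚ.+ sumOver (filter (∁? P?) xs) f
    sumOver-filter-∁ []       f = sym (ℚP.+-identityˡ 0ℚ)
    sumOver-filter-∁ (x ∷ xs) f with P? x
    ... | yes _ = trans (cong (f x ℚ.+_) (sumOver-filter-∁ xs f)) (sym (ℚP.+-assoc (f x) _ _))
    ... | no _  = trans (cong (f x ℚ.+_) (sumOver-filter-∁ xs f))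
      (solve 3 (λ x y z → x :+ (y :+ z) := y :+ (x :+ z)) refl
        (f x) (sumOver (filter P? xs) f) (sumOver (filter (∁? P?) xs) f))

    length-filter-∁ : ∀ xs → length (filter P? xs) + length (filter (∁? P?) xs) ≡ length xs
    length-filter-∁ []       = refl
    length-filter-∁ (x ∷ xs) with P? x
    ... | yes _ = cong suc (length-filter-∁ xs)
    ... | no _  = trans (ℕP.+-suc _ _) (cong suc (length-filter-∁ xs))

InRange : ℕ → ℕ → Set
InRange L n = 1 ≤ n × n ≤ L

InRange-zero : ∀ {n} → ¬ InRange 0 n
InRange-zero (s≤s _ , ())

module _ {A : Set} (h : A → ℕ) where

  fibre : ℕ → List A → List A
  fibre a = filter (λ x → h x ℕP.≟ a)

  offFibre : ℕ → List A → List A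
  offFibre a = filter (∁? (λ x → h x ℕP.≟ a))

  length-fibre-offFibre : ∀ {a b} xs → length (fibre a (offFibre b xs)) ≤ length (fibre a xs)
  length-fibre-offFibre xs =
    Sublist.length-mono-≤ (Sublist.filter⁺ _ _ (λ { refl → id }) (Sublist.filter-⊆ _ xs))

  offFibre-InRange : ∀ {L} xs → All (InRange (suc L) ∘ h) xs → All (InRange L ∘ h) (offFibre (suc L) xs)
  offFibre-InRange {L} xs inRange =
    All.zipWith shrink (filter⁺ _ inRange , all-filter (∁? (λ x → h x ℕP.≟ suc L)) xs)
    where
    shrink : ∀ {x} → InRange (suc L) (h x) × h x ≢ suc L → InRange L (h x)
    shrink ((1≤hx , hx≤1+L) , hx≢1+L) = 1≤hx , s≤s⁻¹ (ℕP.≤∧≢⇒< hx≤1+L hx≢1+L)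

  length≤*fibreBound : ∀ L {m} xs → All (InRange L ∘ h) xs →
                       (∀ a → length (fibre a xs) ≤ m) → length xs ≤ L * m
  length≤*fibreBound zero    []       _            _      = z≤n
  length≤*fibreBound zero    (x ∷ xs) (hx∈0 ∷ _)   _      = contradiction hx∈0 InRange-zero
  length≤*fibreBound (suc L) {m} xs inRange bounded = begin
    length xs                                                  ≡⟨ sym (length-filter-∁ _ xs) ⟩
    length (fibre (suc L) xs) + length (offFibre (suc L) xs)  ≤⟨ ℕP.+-mono-≤ (bounded (suc L)) rest ⟩
    m + L * m                                                  ∎
    where
    open ℕP.≤-Reasoning
    rest : length (offFibre (suc L) xs) ≤ L * m
    rest = length≤*fibreBound L (offFibre (suc L) xs) (offFibre-InRange xs inRange)
             (λ a → ℕP.≤-trans (length-fibre-offFibre xs) (bounded a))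

  pigeonhole : ∀ L xs → All (InRange L ∘ h) xs → ∃ λ a → length xs ≤ L * length (fibre a xs)
  pigeonhole zero    []       _          = zero , z≤n
  pigeonhole zero    (x ∷ xs) (hx∈0 ∷ _) = contradiction hx∈0 InRange-zero
  pigeonhole (suc L) xs inRange = larger (ℕP.≤-total (length (fibre (suc L) xs)) (length (fibre a xs)))
    where
    open ℕP.≤-Reasoning
    rec : ∃ λ a → length (offFibre (suc L) xs) ≤ L * length (fibre a (offFibre (suc L) xs))
    rec = pigeonhole L (offFibre (suc L) xs) (offFibre-InRange xs inRange)
    a : ℕ
    a = proj₁ rec
    split : length xs ≤ length (fibre (suc L) xs) + L * length (fibre a xs)
    split = begin
      length xs
        ≡⟨ sym (length-filter-∁ _ xs) ⟩
      length (fibre (suc L) xs) + length (offFibre (suc L) xs)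
        ≤⟨ ℕP.+-monoʳ-≤ _ (ℕP.≤-trans (proj₂ rec) (ℕP.*-monoʳ-≤ L (length-fibre-offFibre xs))) ⟩
      length (fibre (suc L) xs) + L * length (fibre a xs) ∎
    larger : length (fibre (suc L) xs) ≤ length (fibre a xs) ⊎
             length (fibre a xs) ≤ length (fibre (suc L) xs) →
             ∃ λ b → length xs ≤ suc L * length (fibre b xs)
    larger (inj₁ f≤g) = a     , ℕP.≤-trans split (ℕP.+-monoˡ-≤ _ f≤g)
    larger (inj₂ g≤f) = suc L , ℕP.≤-trans split (ℕP.+-monoʳ-≤ _ (ℕP.*-monoʳ-≤ L g≤f))

head-InRange : ∀ {L s} {q : Vec ℕ (suc s)} → InBox L q → InRange L (head q)
head-InRange (inRange VecAll.∷ _) = inRange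

tail-InBox : ∀ {L s} {q : Vec ℕ (suc s)} → InBox L q → InBox L (tail q)
tail-InBox (_ VecAll.∷ inBox) = inBox

≡-from-head-tail : ∀ {s} {q r : Vec ℕ (suc s)} → head q ≡ head r → tail q ≡ tail r → q ≡ r
≡-from-head-tail {q = _ ∷ _} {_ ∷ _} refl refl = refl

unique-tails : ∀ {s a} {Q : List (Vec ℕ (suc s))} →
               All (λ q → head q ≡ a) Q → Unique Q → Unique (map tail Q)
unique-tails []           []           = []
unique-tails {a = a} {Q = q ∷ _} (q₁≡a ∷ heads) (q∉Q ∷ unique) =
  map⁺ (All.zipWith distinctTails (q∉Q , heads)) ∷ unique-tails heads unique
  where
  distinctTails : ∀ {r} → q ≢ r × head r ≡ a → tail q ≢ tail r
  distinctTails (q≢r , r₁≡a) = q≢r ∘ ≡-from-head-tail (trans q₁≡a (sym r₁≡a))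

fibreTails : ∀ {s} → ℕ → List (Vec ℕ (suc s)) → List (Vec ℕ s)
fibreTails a Q = map tail (fibre head a Q)

fibreTails-unique : ∀ {s} a {Q : List (Vec ℕ (suc s))} → Unique Q → Unique (fibreTails a Q)
fibreTails-unique a {Q} unique =
  unique-tails (all-filter (λ q → head q ℕP.≟ a) Q) (Unique.filter⁺ _ unique)

fibreTails-InBox : ∀ {L s} a {Q : List (Vec ℕ (suc s))} → All (InBox L) Q → All (InBox L) (fibreTails a Q)
fibreTails-InBox a inBox = map⁺ (All.map tail-InBox (filter⁺ _ inBox))

length-fibreTails : ∀ {s} a (Q : List (Vec ℕ (suc s))) → length (fibreTails a Q) ≡ length (fibre head a Q)
length-fibreTails a Q = ListP.length-map tail (fibre head a Q)

length≤pow : ∀ L s (Q : List (Vec ℕ s)) → Unique Q → All (InBox L) Q → length Q ≤ L ^ s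
length-fibre≤pow : ∀ L s a (Q : List (Vec ℕ (suc s))) → Unique Q → All (InBox L) Q →
                   length (fibre head a Q) ≤ L ^ s

length≤pow L zero    []             _                 _     = z≤n
length≤pow L zero    ([] ∷ [])      _                 _     = s≤s z≤n
length≤pow L zero    ([] ∷ [] ∷ _)  ((q≢q ∷ _) ∷ _)   _     = contradiction refl q≢q
length≤pow L (suc s) Q              unique            inBox =
  length≤*fibreBound head L Q (All.map head-InRange inBox) (λ a → length-fibre≤pow L s a Q unique inBox)

length-fibre≤pow L s a Q unique inBox = subst (_≤ L ^ s) (length-fibreTails a Q)
  (length≤pow L s (fibreTails a Q) (fibreTails-unique a unique) (fibreTails-InBox a inBox))

combination : ∀ {t} → List (Vec ℕ t) → (Vec ℕ t → ℚ) → Vec ℕ t → ℚ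
combination Q c i = sumOver Q (λ q → c q ℚ.* toℚ (monomial q i))

SpansBelow : ∀ {t} → ℕ → List (Vec ℕ t) → Set
SpansBelow {t} d Q =
  (w : Vec ℕ t → ℚ) → Σ (Vec ℕ t → ℚ) λ c →
    (i : Vec ℕ t) → degree i ℕ.< d → combination Q c i ≡ w i

SpansBelow-zero : ∀ {t} (Q : List (Vec ℕ t)) → SpansBelow 0 Q
SpansBelow-zero Q w = (λ _ → 0ℚ) , λ _ ()

SpansAll⇒SpansBelow-suc : ∀ {t d} (Q : List (Vec ℕ t)) → SpansAll d Q → SpansBelow (suc d) Q
SpansAll⇒SpansBelow-suc Q spans w = proj₁ (spans w) , λ i deg<1+d → proj₂ (spans w) i (s≤s⁻¹ deg<1+d)

combination-cong : ∀ {t} {Q : List (Vec ℕ t)} {c c′ : Vec ℕ t → ℚ} → All (λ q → c q ≡ c′ q) Q →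
                   ∀ i → combination Q c i ≡ combination Q c′ i
combination-cong c≡c′ i = sumOver-cong (All.map (cong (ℚ._* _)) c≡c′)

monomial-zero : ∀ {s} (q : Vec ℕ (suc s)) i → monomial q (0 ∷ i) ≡ monomial (tail q) i
monomial-zero (_ ∷ q) i = ℕP.*-identityˡ (monomial q i)

monomial-suc : ∀ {s} (q : Vec ℕ (suc s)) k i → monomial q (suc k ∷ i) ≡ head q * monomial q (k ∷ i)
monomial-suc (x ∷ q) k i = ℕP.*-assoc x (x ^ k) (monomial q i)

shiftCoefficients : ∀ {s} → ℚ → (Vec ℕ (suc s) → ℚ) → Vec ℕ (suc s) → ℚ
shiftCoefficients α c q = c q ℚ.* (toℚ (head q) ℚ.- α)

combination-shift : ∀ {s} (Q : List (Vec ℕ (suc s))) c α k i →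
  combination Q c (suc k ∷ i) ≡
    α ℚ.* combination Q c (k ∷ i) ℚ.+ combination Q (shiftCoefficients α c) (k ∷ i)
combination-shift {s} Q c α k i = begin
  combination Q c (suc k ∷ i)
    ≡⟨ sumOver-cong (All.universal expand Q) ⟩
  sumOver Q (λ q → α ℚ.* (c q ℚ.* Y q) ℚ.+ shiftCoefficients α c q ℚ.* Y q)
    ≡⟨ sumOver-+ Q (λ q → α ℚ.* (c q ℚ.* Y q)) (λ q → shiftCoefficients α c q ℚ.* Y q) ⟩
  sumOver Q (λ q → α ℚ.* (c q ℚ.* Y q)) ℚ.+ combination Q (shiftCoefficients α c) (k ∷ i)
    ≡⟨ cong (ℚ._+ combination Q (shiftCoefficients α c) (k ∷ i))
         (sumOver-*ˡ α Q (λ q → c q ℚ.* Y q)) ⟩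
  α ℚ.* combination Q c (k ∷ i) ℚ.+ combination Q (shiftCoefficients α c) (k ∷ i) ∎
  where
  open ≡-Reasoning
  Y : Vec ℕ (suc s) → ℚ
  Y q = toℚ (monomial q (k ∷ i))
  expand : ∀ q → c q ℚ.* toℚ (monomial q (suc k ∷ i)) ≡
                 α ℚ.* (c q ℚ.* Y q) ℚ.+ shiftCoefficients α c q ℚ.* Y q
  expand q = trans (cong (λ m → c q ℚ.* toℚ m) (monomial-suc q k i))
    (trans (cong (c q ℚ.*_) (toℚ-* (head q) (monomial q (k ∷ i))))
      (solve 4 (λ c x α y → c :* (x :* y) := α :* (c :* y) :+ c :* (x :- α) :* y) refl
        (c q) (toℚ (head q)) α (Y q)))

glue : ∀ {s} → ℕ → (Vec ℕ s → ℚ) → (Vec ℕ (suc s) → ℚ) → Vec ℕ (suc s) → ℚ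
glue a c₀ c₁ q with head q ℕP.≟ a
... | yes _ = c₀ (tail q)
... | no _  = c₁ q

glue-fibre : ∀ {s} a c₀ c₁ (Q : List (Vec ℕ (suc s))) →
             All (λ q → glue a c₀ c₁ q ≡ c₀ (tail q)) (fibre head a Q)
glue-fibre a c₀ c₁ Q = All.map (λ {q} → onFibre {q}) (all-filter (λ q → head q ℕP.≟ a) Q)
  where
  onFibre : ∀ {q} → head q ≡ a → glue a c₀ c₁ q ≡ c₀ (tail q)
  onFibre {q} q₁≡a with head q ℕP.≟ a
  ... | yes _    = refl
  ... | no q₁≢a = contradiction q₁≡a q₁≢a

glue-offFibre : ∀ {s} a c₀ c₁ (Q : List (Vec ℕ (suc s))) →
                All (λ q → glue a c₀ c₁ q ≡ c₁ q) (offFibre head a Q)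
glue-offFibre a c₀ c₁ Q = All.map (λ {q} → notOnFibre {q}) (all-filter (∁? (λ q → head q ℕP.≟ a)) Q)
  where
  notOnFibre : ∀ {q} → head q ≢ a → glue a c₀ c₁ q ≡ c₁ q
  notOnFibre {q} q₁≢a with head q ℕP.≟ a
  ... | yes q₁≡a = contradiction q₁≡a q₁≢a
  ... | no _     = refl

combination-split : ∀ {s} a (Q : List (Vec ℕ (suc s))) c i →
  combination Q c i ≡ combination (fibre head a Q) c i ℚ.+ combination (offFibre head a Q) c i
combination-split a Q c i = sumOver-filter-∁ (λ q → head q ℕP.≟ a) Q (λ q → c q ℚ.* toℚ (monomial q i))

combination-glue-zero : ∀ {s} a c₀ c₁ (Q : List (Vec ℕ (suc s))) i →
  combination Q (glue a c₀ c₁) (0 ∷ i) ≡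
    combination (fibreTails a Q) c₀ i ℚ.+ combination (offFibre head a Q) c₁ (0 ∷ i)
combination-glue-zero a c₀ c₁ Q i = begin
  combination Q c (0 ∷ i)
    ≡⟨ combination-split a Q c (0 ∷ i) ⟩
  combination (fibre head a Q) c (0 ∷ i) ℚ.+ combination (offFibre head a Q) c (0 ∷ i)
    ≡⟨ cong₂ ℚ._+_ (sumOver-cong (All.map (λ {q} → onFibre {q}) (glue-fibre a c₀ c₁ Q)))
                   (combination-cong (glue-offFibre a c₀ c₁ Q) (0 ∷ i)) ⟩
  sumOver (fibre head a Q) (λ q → c₀ (tail q) ℚ.* toℚ (monomial (tail q) i)) ℚ.+
    combination (offFibre head a Q) c₁ (0 ∷ i)
    ≡⟨ cong (ℚ._+ combination (offFibre head a Q) c₁ (0 ∷ i))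
         (sym (sumOver-map tail (fibre head a Q) (λ p → c₀ p ℚ.* toℚ (monomial p i)))) ⟩
  combination (fibreTails a Q) c₀ i ℚ.+ combination (offFibre head a Q) c₁ (0 ∷ i) ∎
  where
  open ≡-Reasoning
  c : Vec ℕ (suc _) → ℚ
  c = glue a c₀ c₁
  onFibre : ∀ {q} → c q ≡ c₀ (tail q) →
            c q ℚ.* toℚ (monomial q (0 ∷ i)) ≡ c₀ (tail q) ℚ.* toℚ (monomial (tail q) i)
  onFibre {q} eq = cong₂ (λ x m → x ℚ.* toℚ m) eq (monomial-zero q i)

combination-offFibre : ∀ {s} a (Q : List (Vec ℕ (suc s))) {c c′} →
  All (λ q → c q ≡ 0ℚ) (fibre head a Q) → All (λ q → c q ≡ c′ q) (offFibre head a Q) →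
  ∀ i → combination Q c i ≡ combination (offFibre head a Q) c′ i
combination-offFibre a Q {c} {c′} c≡0 c≡c′ i = begin
  combination Q c i
    ≡⟨ combination-split a Q c i ⟩
  combination (fibre head a Q) c i ℚ.+ combination (offFibre head a Q) c i
    ≡⟨ cong₂ ℚ._+_ (sumOver-zero (All.map (λ {q} → vanish q) c≡0)) (combination-cong c≡c′ i) ⟩
  0ℚ ℚ.+ combination (offFibre head a Q) c′ i
    ≡⟨ ℚP.+-identityˡ _ ⟩
  combination (offFibre head a Q) c′ i ∎
  where
  open ≡-Reasoning
  vanish : ∀ q → c q ≡ 0ℚ → c q ℚ.* toℚ (monomial q i) ≡ 0ℚ
  vanish q c≡0 = trans (cong (ℚ._* toℚ (monomial q i)) c≡0) (ℚP.*-zeroˡ (toℚ (monomial q i)))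

SpansAll-fromFibres : ∀ {s} d a (Q : List (Vec ℕ (suc s))) →
  SpansAll d (fibreTails a Q) → SpansBelow d (offFibre head a Q) → SpansAll d Q
SpansAll-fromFibres {s} d a Q fibreSpans offSpans w = c , solves
  where
  open ≡-Reasoning
  R : List (Vec ℕ (suc s))
  R = offFibre head a Q
  α : ℚ
  α = toℚ a
  δ : Vec ℕ (suc s) → ℚ
  δ q = toℚ (head q) ℚ.- α
  shifted : Vec ℕ (suc s) → ℚ
  shifted (k ∷ i) = w (suc k ∷ i) ℚ.- α ℚ.* w (k ∷ i)
  c₁′ : Vec ℕ (suc s) → ℚ
  c₁′ = proj₁ (offSpans shifted)
  c₁ : Vec ℕ (suc s) → ℚ
  c₁ q = c₁′ q ℚ.* recip (δ q)
  w₀ : Vec ℕ s → ℚ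
  w₀ i = w (0 ∷ i) ℚ.- combination R c₁ (0 ∷ i)
  c₀ : Vec ℕ s → ℚ
  c₀ = proj₁ (fibreSpans w₀)
  c : Vec ℕ (suc s) → ℚ
  c = glue a c₀ c₁

  shifted-onFibre : ∀ {q} → head q ≡ a → shiftCoefficients α c q ≡ 0ℚ
  shifted-onFibre {q} refl = trans (cong (c q ℚ.*_) (ℚP.+-inverseʳ α)) (ℚP.*-zeroʳ (c q))

  shifted-offFibre : ∀ {q} → c q ≡ c₁ q × head q ≢ a → shiftCoefficients α c q ≡ c₁′ q
  shifted-offFibre {q} (c≡c₁ , q₁≢a) = begin
    c q ℚ.* δ q                     ≡⟨ cong (ℚ._* δ q) c≡c₁ ⟩
    c₁′ q ℚ.* recip (δ q) ℚ.* δ q   ≡⟨ ℚP.*-assoc (c₁′ q) _ _ ⟩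
    c₁′ q ℚ.* (recip (δ q) ℚ.* δ q) ≡⟨ cong (c₁′ q ℚ.*_) (recip-inverseˡ (δ q) δ≢0) ⟩
    c₁′ q ℚ.* 1ℚ                    ≡⟨ ℚP.*-identityʳ (c₁′ q) ⟩
    c₁′ q                           ∎
    where
    δ≢0 : δ q ≢ 0ℚ
    δ≢0 = q₁≢a ∘ toℚ-injective ∘ p-q≡0⇒p≡q _ α

  shifted-solves : ∀ k i → degree (k ∷ i) ℕ.< d →
                   combination Q (shiftCoefficients α c) (k ∷ i) ≡ shifted (k ∷ i)
  shifted-solves k i deg = begin
    combination Q (shiftCoefficients α c) (k ∷ i)
      ≡⟨ combination-offFibre a Q
           (All.map (λ {q} → shifted-onFibre {q}) (all-filter (λ q → head q ℕP.≟ a) Q))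
           (All.map (λ {q} → shifted-offFibre {q})
             (All.zip (glue-offFibre a c₀ c₁ Q , all-filter (∁? (λ q → head q ℕP.≟ a)) Q)))
           (k ∷ i) ⟩
    combination R c₁′ (k ∷ i)
      ≡⟨ proj₂ (offSpans shifted) (k ∷ i) deg ⟩
    shifted (k ∷ i) ∎

  solves : (i : Vec ℕ (suc s)) → degree i ≤ d → combination Q c i ≡ w i
  solves (zero ∷ i) deg = begin
    combination Q c (0 ∷ i)
      ≡⟨ combination-glue-zero a c₀ c₁ Q i ⟩
    combination (fibreTails a Q) c₀ i ℚ.+ combination R c₁ (0 ∷ i)
      ≡⟨ cong (ℚ._+ combination R c₁ (0 ∷ i)) (proj₂ (fibreSpans w₀) i deg) ⟩
    w₀ i ℚ.+ combination R c₁ (0 ∷ i)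
      ≡⟨ solve 2 (λ x y → (x :- y) :+ y := x) refl (w (0 ∷ i)) (combination R c₁ (0 ∷ i)) ⟩
    w (0 ∷ i) ∎
  solves (suc k ∷ i) deg = begin
    combination Q c (suc k ∷ i)
      ≡⟨ combination-shift Q c α k i ⟩
    α ℚ.* combination Q c (k ∷ i) ℚ.+ combination Q (shiftCoefficients α c) (k ∷ i)
      ≡⟨ cong₂ (λ x y → α ℚ.* x ℚ.+ y) (solves (k ∷ i) (ℕP.<⇒≤ deg)) (shifted-solves k i deg) ⟩
    α ℚ.* w (k ∷ i) ℚ.+ (w (suc k ∷ i) ℚ.- α ℚ.* w (k ∷ i))
      ≡⟨ solve 3 (λ α x y → α :* x :+ (y :- α :* x) := y) refl α (w (k ∷ i)) (w (suc k ∷ i)) ⟩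
    w (suc k ∷ i) ∎

-- n > d·L^(s-1), i.e. the density hypothesis with C = d, multiplied through by L.
Large : ℕ → ℕ → ℕ → ℕ → Set
Large L d s n = d * L ^ s ℕ.< n * L

Large-fibre : ∀ {L} d s {n f} → Large L d (suc s) n → n ≤ L * f → Large L d s f
Large-fibre {L} d s {n} {f} large n≤Lf = ℕP.*-cancelˡ-< L (d * L ^ s) (f * L) (begin-strict
  L * (d * L ^ s) ≡⟨ x∙yz≈y∙xz L d (L ^ s) ⟩
  d * (L * L ^ s) <⟨ large ⟩
  n * L           ≤⟨ ℕP.*-monoˡ-≤ L n≤Lf ⟩
  L * f * L       ≡⟨ ℕP.*-assoc L f L ⟩
  L * (f * L)     ∎)
  where open ℕP.≤-Reasoning

Large-offFibre : ∀ {L} d s {f r} → Large L (suc d) (suc s) (f + r) → f ≤ L ^ s → Large L d (suc s) r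
Large-offFibre {L} d s {f} {r} large f≤Lˢ = ℕP.+-cancelˡ-< (L ^ suc s) (d * L ^ suc s) (r * L) (begin-strict
  L ^ suc s + d * L ^ suc s ≡⟨⟩
  suc d * L ^ suc s         <⟨ large ⟩
  (f + r) * L               ≡⟨ ℕP.*-distribʳ-+ L f r ⟩
  f * L + r * L             ≤⟨ ℕP.+-monoˡ-≤ (r * L) (ℕP.*-monoˡ-≤ L f≤Lˢ) ⟩
  L ^ s * L + r * L         ≡⟨ cong (_+ r * L) (ℕP.*-comm (L ^ s) L) ⟩
  L ^ suc s + r * L         ∎)
  where open ℕP.≤-Reasoning

SpansAll-dim0 : ∀ {L} d (Q : List (Vec ℕ 0)) → Unique Q → Large L d 0 (length Q) → SpansAll d Q
SpansAll-dim0 d []            _                 large = contradiction large ℕP.n≮0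
SpansAll-dim0 d ([] ∷ [])     _                 _     w =
  (λ _ → w []) , λ { [] _ → trans (ℚP.+-identityʳ _) (ℚP.*-identityʳ (w [])) }
SpansAll-dim0 d ([] ∷ [] ∷ _) ((q≢q ∷ _) ∷ _)   _     = contradiction refl q≢q

Large⇒SpansAll : ∀ L d s (Q : List (Vec ℕ s)) → Unique Q → All (InBox L) Q → Large L d s (length Q) →
                 SpansAll d Q
Large⇒SpansAll L d zero    Q unique _     large = SpansAll-dim0 d Q unique large
Large⇒SpansAll L d (suc s) Q unique inBox large =
  SpansAll-fromFibres d a Q
    (Large⇒SpansAll L d s (fibreTails a Q) (fibreTails-unique a unique) (fibreTails-InBox a inBox)
      (subst (Large L d s) (sym (length-fibreTails a Q)) (Large-fibre d s large (proj₂ crowded))))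
    (offFibre-spansBelow d large)
  where
  crowded : ∃ λ a → length Q ≤ L * length (fibre head a Q)
  crowded = pigeonhole head L Q (All.map head-InRange inBox)
  a : ℕ
  a = proj₁ crowded
  R : List (Vec ℕ (suc s))
  R = offFibre head a Q
  offFibre-spansBelow : ∀ d → Large L d (suc s) (length Q) → SpansBelow d R
  offFibre-spansBelow zero    _     = SpansBelow-zero R
  offFibre-spansBelow (suc d) large = SpansAll⇒SpansBelow-suc R
    (Large⇒SpansAll L d (suc s) R (Unique.filter⁺ _ unique) (filter⁺ _ inBox)
      (Large-offFibre d s (subst (Large L (suc d) (suc s)) (sym (length-filter-∁ _ Q)) large)
        (length-fibre≤pow L s a Q unique inBox)))

density⇒Large : ∀ {L t n d ε} → 1 ≤ L →
                toℚ n ≡ ε ℚ.* toℚ (L ^ t) → toℚ d < ε ℚ.* toℚ L → Large L d t n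
density⇒Large {L} {t} {n} {d} {ε} 1≤L n≡εLᵗ d<εL = toℚ-cancel-< (begin-strict
  toℚ (d * L ^ t)             ≡⟨ toℚ-* d (L ^ t) ⟩
  toℚ d ℚ.* toℚ (L ^ t)       <⟨ ℚP.*-monoˡ-<-pos (toℚ (L ^ t)) {{Lᵗ-positive}} d<εL ⟩
  ε ℚ.* toℚ L ℚ.* toℚ (L ^ t) ≡⟨ solve 3 (λ e l p → e :* l :* p := e :* p :* l) refl
                                   ε (toℚ L) (toℚ (L ^ t)) ⟩
  ε ℚ.* toℚ (L ^ t) ℚ.* toℚ L ≡⟨ cong (ℚ._* toℚ L) (sym n≡εLᵗ) ⟩
  toℚ n ℚ.* toℚ L             ≡⟨ toℚ-* n L ⟨
  toℚ (n * L)                 ∎)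
  where
  open ℚP.≤-Reasoning
  Lᵗ-positive : ℚ.Positive (toℚ (L ^ t))
  Lᵗ-positive = toℚ-positive (ℕP.m^n>0 L {{>-nonZero 1≤L}} t)

lemma3p2 : (d t : ℕ) → 1 ≤ d → 1 ≤ t →
    Σ ℚ λ C →
      (L : ℕ) → 1 ≤ L → (ε : ℚ) → 0ℚ < ε →
      (𝓠 : List (Vec ℕ t)) → Unique 𝓠 → All (InBox L) 𝓠 →
      toℚ (length 𝓠) ≡ ε ℚ.* toℚ (L ^ t) →
      C < ε ℚ.* toℚ L →
      SpansAll d 𝓠
lemma3p2 d t _ _ = toℚ d , λ L 1≤L ε _ 𝓠 unique inBox |𝓠|≡εLᵗ d<εL →
  Large⇒SpansAll L d t 𝓠 unique inBox (density⇒Large {t = t} {length 𝓠} {d} {ε} 1≤L |𝓠|≡εLᵗ d<εL)
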